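{- Let $M=(AP_f,S,T,V,\{\sim_o\}_{o\in\mathcal{O}},s_{\mathrm{init}},o_{\mathrm{init}})$ be a Kripke structure with observations. For every history $h\cdot s$ of $M$ (a history $h$ extended by a state $s$), every observation record $r$ that stops at $h$, and every observation $o\in\mathcal{O}$, \[ \mathit{IS}(h\cdot s,r)=U_T(\mathit{IS}(h,r),\,s,\,o(h,r))\quad\text{and}\quad \mathit{IS}(h,\,r\cdot(o,|h|-1))=U_\Delta(\mathit{IS}(h,r),\,\mathrm{last}(h),\,o). \]
   Context: A Kripke structure with observations is $M=(AP_f,S,T,V,\{\sim_o\}_{o\in\mathcal{O}},s_{\mathrm{init}},o_{\mathrm{init}})$ where $AP_f$ is a finite set of atomic propositions, $S$ a set of states, $T\subseteq S\times S$ a left-total transition relation, $V:S\to 2^{AP_f}$ a valuation, $\mathcal{O}$ a finite set of observations and each $\sim_o\subseteq S\times S$ ($o\in\mathcal{O}$) an equivalence relation, $s_{\mathrm{init}}\in S$ the initial state and $o_{\mathrm{init}}\in\mathcal{O}$ the initial observation. A path is an infinite sequence $s_0s_1\dots$ with $s_iTs_{i+1}$ for all $i$; a history is a finite nonempty prefix of a path. For a finite word $w=w_0\dots w_n$, $|w|=n+1$ and $\mathrm{last}(w)=w_n$. For $I\subseteq S$, $T(I)=\{s'\mid \exists s\in I,\ sTs'\}$; $[s]_o=\{s'\mid s\sim_o s'\}$. An observation record is a finite word over $\mathcal{O}\times\mathbb{N}$; $r\cdot(o,n)$ denotes appending $(o,n)$. $r_{=n}$ is the subsequence of pairs $(o,m)$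 of $r$ with $m=n$. $r$ stops at $n$ if $r_{=m}$ is empty for all $m>n$, and stops at history $h$ if it stops at $|h|-1$. The list of observations at time $n$ is defined by $\mathrm{ol}(r,0)=o_{\mathrm{init}}\cdot o_1\cdots o_k$ if $r_{=0}=(o_1,0)\cdots(o_k,0)$, and $\mathrm{ol}(r,n+1)=\mathrm{last}(\mathrm{ol}(r,n))\cdot o_1\cdots o_k$ if $r_{=n+1}=(o_1,n+1)\cdots(o_k,n+1)$. The last observation $o(h,r)$ is the last element of $\mathrm{ol}(r,|h|-1)$. Two histories are equivalent, $h\sim_r h'$, if $|h|=|h'|$ and for all $i<|h|$ and all $o\in\mathrm{ol}(r,i)$, $h_i\sim_o h'_i$. The information set is $\mathit{IS}(h,r)=\{s\in S\mid \exists h',\ h'\sim_r h \text{ and } \mathrm{last}(h')=s\}$. Update functions: for $I\subseteq S$, $s,s'\in S$, $o,o'\in\mathcal{O}$: $U_T(I,s',o)=T(I)\cap[s']_o$ and $U_\Delta(I,s,o')=I\cap[s]_{o'}$. -}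

module Defs where

open import Data.Nat using (ℕ; zero; suc; _<_; _≟_)
open import Data.Fin using (Fin; toℕ)
open import Data.Product using (Σ; ∃; _×_; _,_; proj₁; proj₂)
open import Data.List using (List; []; filter; map)
open import Data.List.NonEmpty as L⁺ using (List⁺; _∷_; toList)
open import Data.List.Membership.Propositional using (_∈_)
open import Data.Vec as V using (Vec; lookup)
open import Data.Fin.Subset using (Subset)
open import Relation.Binary.PropositionalEquality using (_≡_)
open import Relation.Binary.Structures using (IsEquivalence)

record KripkeObs (nAP nO : ℕ) : Set₁ where
  field
    S         : Set
    T         : S → S → Set
    leftTotal : ∀ s → ∃ λ s' → T s s'
    V         : S → Subset nAP
    obsRel    : Fin nO → S → S → Set
    obsEquiv  : ∀ o → IsEquivalence (obsRel o)
    sinit     : S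
    oinit     : Fin nO

module _ {nAP nO : ℕ} (M : KripkeObs nAP nO) where
  open KripkeObs M

  Obs : Set
  Obs = Fin nO

  Pred : Set₁
  Pred = S → Set

  _≐_ : Pred → Pred → Set
  A ≐ B = ∀ x → (A x → B x) × (B x → A x)

  Path : Set
  Path = Σ (ℕ → S) λ π → ∀ i → T (π i) (π (suc i))

  IsHistory : ∀ {n} → Vec S (suc n) → Set
  IsHistory {n} h = Σ Path λ π → ∀ (i : Fin (suc n)) → lookup h i ≡ proj₁ π (toℕ i)

  ObsRecord : Set
  ObsRecord = List (Obs × ℕ)

  _=at_ : ObsRecord → ℕ → ObsRecord
  r =at n = filter (λ p → proj₂ p ≟ n) r

  StopsAt : ObsRecord → ℕ → Set
  StopsAt r n = ∀ m → n < m → r =at m ≡ []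

  ol : ObsRecord → ℕ → List⁺ Obs
  ol r zero    = oinit ∷ map proj₁ (r =at zero)
  ol r (suc n) = L⁺.last (ol r n) ∷ map proj₁ (r =at suc n)

  lastObs : ∀ {n} → Vec S (suc n) → ObsRecord → Obs
  lastObs {n} h r = L⁺.last (ol r n)

  -- h ∼_r h'  (equal lengths enforced by the type)
  _∼[_]_ : ∀ {n} → Vec S (suc n) → ObsRecord → Vec S (suc n) → Set
  _∼[_]_ {n} h r h' = ∀ (i : Fin (suc n)) (o : Obs) → o ∈ toList (ol r (toℕ i)) →
                       obsRel o (lookup h i) (lookup h' i)

  IS : ∀ {n} → Vec S (suc n) → ObsRecord → Pred
  IS {n} h r s = Σ (Vec S (suc n)) λ h' → IsHistory h' × (h' ∼[ r ] h) × V.last h' ≡ s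

  post : Pred → Pred
  post I s' = Σ S λ s → I s × T s s'

  eqClass : S → Obs → Pred
  eqClass s o s' = obsRel o s s'

  _∩_ : Pred → Pred → Pred
  (A ∩ B) x = A x × B x

  U-T : Pred → S → Obs → Pred
  U-T I s' o = post I ∩ eqClass s' o

  U-Δ : Pred → S → Obs → Pred
  U-Δ I s o' = I ∩ eqClass s o'

module Submission where

-- Both equations follow from two characterisations of the equivalence
-- relation ∼_r on histories.  Splitting a history of length n+1 into its
-- first n entries and its last one (`∼-split`) shows:
--   * extending both histories by one state (r stopping at h, so that
--     ol(r, n+1) is the single observation o(h,r)) adds exactly the
--     condition that the new states are ∼_{o(h,r)}-related (`∼-snoc`);
--   * appending (o, n) to the record leaves ol(r, i) unchanged for i < n and
--     appends o to ol(r, n), which adds exactly the condition that the last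
--     states are ∼_o-related (`∼-record-snoc`).
-- Together with the fact that h·x is a history iff h is one and T (last h) x
-- (`history-init`, `history-snoc`; the latter splices a path through h with
-- an infinite run from x obtained from left-totality of T), unfolding IS
-- gives `IS-step` and `IS-observe`, the two halves of the proposition.

open import Defs
open import Data.Nat using (ℕ; zero; suc; _≤_; _<_; _≟_; z≤n; s≤s)
open import Data.Nat.Properties using (<⇒≢; <-trans; n<1+n)
open import Data.Fin using (Fin; toℕ; inject₁; fromℕ)
import Data.Fin as F
open import Data.Fin.Properties using (toℕ-inject₁; toℕ-fromℕ; toℕ<n; toℕ≤pred[n])
open import Data.Product using (_×_; _,_; proj₁; proj₂)
open import Data.Sum using ([_,_]′)
open import Data.List using (List; [_]; _++_)
open import Data.List.Properties using (filter-++; filter-accept; filter-reject; map-++; ++-identityʳ)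
import Data.List as L
open import Data.List.NonEmpty as L⁺ using (toList)
open import Data.List.Membership.Propositional using (_∈_)
open import Data.List.Membership.Propositional.Properties using (∈-++⁺ˡ; ∈-++⁺ʳ; ∈-++⁻)
open import Data.List.Relation.Unary.Any using (here)
open import Data.Vec using (Vec; _∷ʳ_; last; lookup; initLast)
import Data.Vec as V
open import Data.Vec.Properties using (last-∷ʳ)
open import Function.Bundles using (_⇔_; mk⇔; Equivalence)
open import Relation.Binary.PropositionalEquality
  using (_≡_; refl; sym; trans; cong; subst₂; module ≡-Reasoning)
open import Relation.Binary.Structures using (IsEquivalence)

open Equivalence using (to; from)

module _ {A : Set} where

  lookup-∷ʳ-inject₁ : ∀ {m} (v : Vec A m) x (j : Fin m) →
                      lookup (v ∷ʳ x) (inject₁ j) ≡ lookup v j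
  lookup-∷ʳ-inject₁ (a V.∷ v) x F.zero    = refl
  lookup-∷ʳ-inject₁ (a V.∷ v) x (F.suc j) = lookup-∷ʳ-inject₁ v x j

  lookup-∷ʳ-fromℕ : ∀ {m} (v : Vec A m) x → lookup (v ∷ʳ x) (fromℕ m) ≡ x
  lookup-∷ʳ-fromℕ V.[]       x = refl
  lookup-∷ʳ-fromℕ (a V.∷ v) x = lookup-∷ʳ-fromℕ v x

  data SnocView {m} : Vec A (suc m) → Set where
    snoc : (u : Vec A m) (x : A) → SnocView (u ∷ʳ x)

  snocView : ∀ {m} (v : Vec A (suc m)) → SnocView v
  snocView v with (u , x , refl) ← initLast v = snoc u x

  last≡lookup-fromℕ : ∀ {m} (v : Vec A (suc m)) → last v ≡ lookup v (fromℕ m)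
  last≡lookup-fromℕ v with snocView v
  ... | snoc u x = trans (last-∷ʳ x u) (sym (lookup-∷ʳ-fromℕ u x))

data InitOrLast {m : ℕ} : Fin (suc m) → Set where
  init-index : (j : Fin m) → InitOrLast (inject₁ j)
  last-index : InitOrLast (fromℕ m)

initOrLast : ∀ {m} (i : Fin (suc m)) → InitOrLast i
initOrLast {zero}  F.zero    = last-index
initOrLast {suc m} F.zero    = init-index F.zero
initOrLast {suc m} (F.suc i) with initOrLast i
... | init-index j = init-index (F.suc j)
... | last-index   = last-index

-- Infinite R-chains and splicing: follow f up to time n, then continue with g.
-- Needed to extend a history by one transition to a prefix of a path.
module _ {A : Set} (R : A → A → Set) where

  Chain : (ℕ → A) → Set
  Chain f = ∀ i → R (f i) (f (suc i))

  splice : (ℕ → A) → ℕ → (ℕ → A) → ℕ → A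
  splice f zero    g zero    = f zero
  splice f zero    g (suc i) = g i
  splice f (suc n) g zero    = f zero
  splice f (suc n) g (suc i) = splice (λ k → f (suc k)) n g i

  splice-≤ : ∀ f n g i → i ≤ n → splice f n g i ≡ f i
  splice-≤ f zero    g zero    _       = refl
  splice-≤ f (suc n) g zero    _       = refl
  splice-≤ f (suc n) g (suc i) (s≤s p) = splice-≤ (λ k → f (suc k)) n g i p

  splice-suc : ∀ f n g → splice f n g (suc n) ≡ g zero
  splice-suc f zero    g = refl
  splice-suc f (suc n) g = splice-suc (λ k → f (suc k)) n g

  splice-chain : ∀ f n g → Chain f → R (f n) (g zero) → Chain g → Chain (splice f n g)
  splice-chain f zero    g cf link cg zero    = link
  splice-chain f zero    g cf link cg (suc i) = cg i
  splice-chain f (suc n) g cf link cg zero    =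
    subst₂ R refl (sym (splice-≤ (λ k → f (suc k)) n g zero z≤n)) (cf zero)
  splice-chain f (suc n) g cf link cg (suc i) =
    splice-chain (λ k → f (suc k)) n g (λ k → cf (suc k)) link cg i

module _ {nAP nO : ℕ} (M : KripkeObs nAP nO) where
  open KripkeObs M

  -- Each ∼_o is symmetric; needed because U_T and U_Δ relate the new state
  -- to the reference state in the opposite order from ∼_r.
  ∼ₒ-sym : ∀ o {x y} → obsRel o x y → obsRel o y x
  ∼ₒ-sym o = IsEquivalence.sym (obsEquiv o)

  Follows : ∀ {n} → Vec S (suc n) → (ℕ → S) → Set
  Follows h π = ∀ i → lookup h i ≡ π (toℕ i)

  follows-init : ∀ {n} (h : Vec S (suc n)) x π → Follows (h ∷ʳ x) π → Follows h π
  follows-init h x π fol j =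
    trans (sym (lookup-∷ʳ-inject₁ h x j)) (trans (fol (inject₁ j)) (cong π (toℕ-inject₁ j)))

  follows-last : ∀ {n} (h : Vec S (suc n)) π → Follows h π → last h ≡ π n
  follows-last {n} h π fol =
    trans (last≡lookup-fromℕ h) (trans (fol (fromℕ n)) (cong π (toℕ-fromℕ n)))

  run : S → ℕ → S
  run x zero    = x
  run x (suc k) = proj₁ (leftTotal (run x k))

  run-chain : ∀ x → Chain T (run x)
  run-chain x i = proj₂ (leftTotal (run x i))

  history-init : ∀ {n} (h : Vec S (suc n)) x →
                 IsHistory M (h ∷ʳ x) → IsHistory M h × T (last h) x
  history-init {n} h x ((π , chain) , fol) =
    ((π , chain) , fol-h) , subst₂ T (sym (follows-last h π fol-h)) (sym x≡π[n+1]) (chain n)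
    where
      fol-h : Follows h π
      fol-h = follows-init h x π fol
      x≡π[n+1] : x ≡ π (suc n)
      x≡π[n+1] = trans (sym (last-∷ʳ x h)) (follows-last (h ∷ʳ x) π fol)

  history-snoc : ∀ {n} (h : Vec S (suc n)) x →
                 IsHistory M h → T (last h) x → IsHistory M (h ∷ʳ x)
  history-snoc {n} h x ((π , chain) , fol) step =
    (π′ , splice-chain T π n (run x) chain link (run-chain x)) , fol′
    where
      π′ : ℕ → S
      π′ = splice T π n (run x)
      link : T (π n) x
      link = subst₂ T (follows-last h π fol) refl step
      fol′ : Follows (h ∷ʳ x) π′
      fol′ i with initOrLast i
      ... | init-index j = begin
        lookup (h ∷ʳ x) (inject₁ j) ≡⟨ lookup-∷ʳ-inject₁ h x j ⟩
        lookup h j                  ≡⟨ fol j ⟩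
        π (toℕ j)                   ≡⟨ sym (splice-≤ T π n (run x) (toℕ j) (toℕ≤pred[n] j)) ⟩
        π′ (toℕ j)                  ≡⟨ cong π′ (sym (toℕ-inject₁ j)) ⟩
        π′ (toℕ (inject₁ j))        ∎
        where open ≡-Reasoning
      ... | last-index = begin
        lookup (h ∷ʳ x) (fromℕ (suc n)) ≡⟨ lookup-∷ʳ-fromℕ h x ⟩
        x                               ≡⟨ sym (splice-suc T π n (run x)) ⟩
        π′ (suc n)                      ≡⟨ cong π′ (sym (toℕ-fromℕ (suc n))) ⟩
        π′ (toℕ (fromℕ (suc n)))        ∎
        where open ≡-Reasoning

  Indist : List (Obs M) → S → S → Set
  Indist os x y = ∀ o → o ∈ os → obsRel o x y

  olAt : ObsRecord M → ℕ → List (Obs M)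
  olAt r k = toList (ol M r k)

  Indist-cong : ∀ {os os′ x x′ y y′} → os ≡ os′ → x ≡ x′ → y ≡ y′ →
                Indist os x y → Indist os′ x′ y′
  Indist-cong refl refl refl ind = ind

  Indist-[] : ∀ {o x y} → Indist [ o ] x y ⇔ obsRel o x y
  Indist-[] {o} = mk⇔ (λ ind → ind o (here refl)) (λ { rel _ (here refl) → rel })

  Indist-++ : ∀ {os os′ x y} → Indist (os ++ os′) x y ⇔ (Indist os x y × Indist os′ x y)
  Indist-++ {os} {os′} = mk⇔
    (λ ind → (λ o m → ind o (∈-++⁺ˡ m)) , (λ o m → ind o (∈-++⁺ʳ os m)))
    (λ { (ind , ind′) o m → [ ind o , ind′ o ]′ (∈-++⁻ os m) })

  AgreeBefore : ∀ {n} → Vec S (suc n) → ObsRecord M → Vec S (suc n) → Set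
  AgreeBefore {n} h r h′ =
    ∀ (j : Fin n) → Indist (olAt r (toℕ j)) (lookup h (inject₁ j)) (lookup h′ (inject₁ j))

  ∼-split : ∀ {n} (h h′ : Vec S (suc n)) r →
            _∼[_]_ M h r h′ ⇔ (AgreeBefore h r h′ × Indist (olAt r n) (last h) (last h′))
  ∼-split {n} h h′ r = mk⇔
    (λ rel → (λ j → Indist-cong (cong (olAt r) (toℕ-inject₁ j)) refl refl (rel (inject₁ j)))
           , Indist-cong (cong (olAt r) (toℕ-fromℕ n)) (sym (last≡lookup-fromℕ h))
                         (sym (last≡lookup-fromℕ h′)) (rel (fromℕ n)))
    combine
    where
      combine : AgreeBefore h r h′ × Indist (olAt r n) (last h) (last h′) → _∼[_]_ M h r h′
      combine (before , now) i with initOrLast i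
      ... | init-index j = Indist-cong (cong (olAt r) (sym (toℕ-inject₁ j))) refl refl (before j)
      ... | last-index   = Indist-cong (cong (olAt r) (sym (toℕ-fromℕ n)))
                             (last≡lookup-fromℕ h) (last≡lookup-fromℕ h′) now

  ∼-snoc : ∀ {n} (h h′ : Vec S (suc n)) x y r →
           _∼[_]_ M (h ∷ʳ x) r (h′ ∷ʳ y) ⇔ (_∼[_]_ M h r h′ × Indist (olAt r (suc n)) x y)
  ∼-snoc h h′ x y r = mk⇔
    (λ rel → let before , now = to (∼-split (h ∷ʳ x) (h′ ∷ʳ y) r) rel in
      (λ j → Indist-cong refl (lookup-∷ʳ-inject₁ h x j) (lookup-∷ʳ-inject₁ h′ y j) (before j))
      , Indist-cong refl (last-∷ʳ x h) (last-∷ʳ y h′) now)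
    (λ { (rel , now) → from (∼-split (h ∷ʳ x) (h′ ∷ʳ y) r)
      ( (λ j → Indist-cong refl (sym (lookup-∷ʳ-inject₁ h x j)) (sym (lookup-∷ʳ-inject₁ h′ y j)) (rel j))
      , Indist-cong refl (sym (last-∷ʳ x h)) (sym (last-∷ʳ y h′)) now) })

  olAt-after-stop : ∀ r n → StopsAt M r n → olAt r (suc n) ≡ [ L⁺.last (ol M r n) ]
  olAt-after-stop r n stops rewrite stops (suc n) (n<1+n n) = refl

  =at-∷ʳ-other : ∀ r o n i → i < n → _=at_ M (r L.∷ʳ (o , n)) i ≡ _=at_ M r i
  =at-∷ʳ-other r o n i i<n = begin
    _=at_ M (r L.∷ʳ (o , n)) i       ≡⟨ filter-++ (λ p → proj₂ p ≟ i) r [ (o , n) ] ⟩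
    _=at_ M r i ++ _=at_ M [ (o , n) ] i
      ≡⟨ cong (_=at_ M r i ++_) (filter-reject (λ p → proj₂ p ≟ i) (λ n≡i → <⇒≢ i<n (sym n≡i))) ⟩
    _=at_ M r i ++ L.[]              ≡⟨ ++-identityʳ _ ⟩
    _=at_ M r i                      ∎
    where open ≡-Reasoning

  =at-∷ʳ-same : ∀ r o n → _=at_ M (r L.∷ʳ (o , n)) n ≡ _=at_ M r n ++ [ (o , n) ]
  =at-∷ʳ-same r o n = trans (filter-++ (λ p → proj₂ p ≟ n) r [ (o , n) ])
    (cong (_=at_ M r n ++_) (filter-accept (λ p → proj₂ p ≟ n) refl))

  ol-∷ʳ-before : ∀ r o n i → i < n → ol M (r L.∷ʳ (o , n)) i ≡ ol M r i
  ol-∷ʳ-before r o n zero    0<n rewrite =at-∷ʳ-other r o n zero 0<n = refl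
  ol-∷ʳ-before r o n (suc i) i<n
    rewrite =at-∷ʳ-other r o n (suc i) i<n
          | ol-∷ʳ-before r o n i (<-trans (n<1+n i) i<n) = refl

  olAt-∷ʳ-now : ∀ r o n → olAt (r L.∷ʳ (o , n)) n ≡ olAt r n ++ [ o ]
  olAt-∷ʳ-now r o zero    rewrite =at-∷ʳ-same r o zero =
    cong (oinit L.∷_) (map-++ proj₁ (_=at_ M r zero) _)
  olAt-∷ʳ-now r o (suc m) rewrite =at-∷ʳ-same r o (suc m) | ol-∷ʳ-before r o (suc m) m (n<1+n m) =
    cong (L⁺.last (ol M r m) L.∷_) (map-++ proj₁ (_=at_ M r (suc m)) _)

  ∼-record-snoc : ∀ {n} (h h′ : Vec S (suc n)) r o →
                  _∼[_]_ M h (r L.∷ʳ (o , n)) h′ ⇔ (_∼[_]_ M h r h′ × obsRel o (last h) (last h′))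
  ∼-record-snoc {n} h h′ r o = mk⇔
    (λ rel → let before , now = to (∼-split h h′ (r L.∷ʳ (o , n))) rel
                 now-r , now-o = to Indist-++ (Indist-cong (olAt-∷ʳ-now r o n) refl refl now) in
      from (∼-split h h′ r) ((λ j → Indist-cong (same j) refl refl (before j)) , now-r)
      , to Indist-[] now-o)
    (λ { (rel , rel-o) → let before , now = to (∼-split h h′ r) rel in
      from (∼-split h h′ (r L.∷ʳ (o , n)))
        ( (λ j → Indist-cong (sym (same j)) refl refl (before j))
        , Indist-cong (sym (olAt-∷ʳ-now r o n)) refl refl
                      (from Indist-++ (now , from Indist-[] rel-o))) })
    where
      same : ∀ (j : Fin n) → olAt (r L.∷ʳ (o , n)) (toℕ j) ≡ olAt r (toℕ j)
      same j = cong toList (ol-∷ʳ-before r o n (toℕ j) (toℕ<n j))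

  IS-step : ∀ n (h : Vec S (suc n)) s r → StopsAt M r n →
            _≐_ M (IS M (h ∷ʳ s) r) (U-T M (IS M h r) s (lastObs M h r))
  IS-step n h s r stops x = forward , backward
    where
      -- under the stopping hypothesis ∼-snoc adds just the last-observation condition
      indist-now : ∀ {y z} → Indist (olAt r (suc n)) y z ⇔ obsRel (lastObs M h r) y z
      indist-now = mk⇔
        (λ ind → to Indist-[] (Indist-cong (olAt-after-stop r n stops) refl refl ind))
        (λ rel → Indist-cong (sym (olAt-after-stop r n stops)) refl refl (from Indist-[] rel))

      forward : IS M (h ∷ʳ s) r x → U-T M (IS M h r) s (lastObs M h r) x
      forward (h″ , hist , rel , last≡x) with snocView h″
      ... | snoc h′ z with history-init h′ z hist | to (∼-snoc h′ h z s r) rel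
      ... | hist′ , step | rel′ , now rewrite trans (sym (last-∷ʳ z h′)) last≡x =
        (last h′ , (h′ , hist′ , rel′ , refl) , step) , ∼ₒ-sym _ (to indist-now now)

      backward : U-T M (IS M h r) s (lastObs M h r) x → IS M (h ∷ʳ s) r x
      backward ((_ , (h′ , hist′ , rel′ , refl) , step) , s∼x) =
        h′ ∷ʳ x , history-snoc h′ x hist′ step
        , from (∼-snoc h′ h x s r) (rel′ , from indist-now (∼ₒ-sym _ s∼x)) , last-∷ʳ x h′

  IS-observe : ∀ n (h : Vec S (suc n)) r o →
               _≐_ M (IS M h (r L.∷ʳ (o , n))) (U-Δ M (IS M h r) (last h) o)
  IS-observe n h r o x = forward , backward
    where
      forward : IS M h (r L.∷ʳ (o , n)) x → U-Δ M (IS M h r) (last h) o x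
      forward (h′ , hist′ , rel , refl) with to (∼-record-snoc h′ h r o) rel
      ... | rel′ , rel-o = (h′ , hist′ , rel′ , refl) , ∼ₒ-sym o rel-o

      backward : U-Δ M (IS M h r) (last h) o x → IS M h (r L.∷ʳ (o , n)) x
      backward ((h′ , hist′ , rel′ , refl) , rel-o) =
        h′ , hist′ , from (∼-record-snoc h′ h r o) (rel′ , ∼ₒ-sym o rel-o) , refl

proposition15 : ∀ {nAP nO} (M : KripkeObs nAP nO) (n : ℕ)
    (h : Vec (KripkeObs.S M) (suc n)) (s : KripkeObs.S M) →
    IsHistory M (h ∷ʳ s) →
    (r : ObsRecord M) → StopsAt M r n → (o : Obs M) →
    _≐_ M (IS M (h ∷ʳ s) r) (U-T M (IS M h r) s (lastObs M h r))
    × _≐_ M (IS M h (r L.∷ʳ (o , n))) (U-Δ M (IS M h r) (last h) o)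
proposition15 M n h s _ r stops o = IS-step M n h s r stops , IS-observe M n h r o
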